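{- Let $G=(V,E,\mathrm{head},\mathrm{tail})$ be a multi-digraph with arc weight $\omega:E\to\mathbb{R}^+$, and let $e\in E$ with $G_e\neq\emptyset$ and $I_e=\emptyset$. Let $\delta$ be a minimum $s$-$t$-cut in $G_e$ with respect to $\omega|_{G_e}$, where $s=\mathrm{head}(e)$, $t=\mathrm{tail}(e)$. Let $\varepsilon$ be a minimum feedback arc set of $(G,\omega)$ and $\varepsilon'=\varepsilon\cap\mathcal{E}(G_e)$. If $$\Omega_{G,\omega}(\delta)-\Omega_{G,\omega}(\vec F(e))>\Omega(G\setminus\vec F(e),\omega)-\Omega(G\setminus\varepsilon',\omega),$$ then $\vec F(e)\subseteq\varepsilon$.
   Context: A multi-digraph is $G=(V,E,\mathrm{head},\mathrm{tail})$ with $V,E$ finite sets and $\mathrm{head},\mathrm{tail}:E\to V$ arbitrary maps (parallel arcs and loops allowed; arcs are distinguished elements of $E$). For $e\in E$, $\vec F(e)=\{f\in E:\mathrm{head}(f)=\mathrm{head}(e),\ \mathrm{tail}(f)=\mathrm{tail}(e)\}$. A directed cycle is a closed directed walk; it is elementary if it visits every vertex at most once; $\mathrm{O}_{\mathrm{el}}(G)$ is the set of elementary cycles. $G\setminus A$ denotes $G$ with the arc set $A$ deleted; $\mathcal{E}(H)$ is the arc set of a subgraph $H$. For $A\subseteq E$, $\Omega_{G,\omega}(A)=\sum_{a\in A}\omega(a)$. A feedback arc set of $(H,\omega)$ is a set of arcs whose removal makes $H$ acyclic; a minimum one minimizes total weight, and $\Omega(H,\omega)$ denotes this minimum total weight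 (the minimum feedback arc length of $H$). Cycle cover: $G_e$ is the subgraph of $G$ induced by all elementary cycles of $G$ that contain $e$ or some arc of $\vec F(e)$. Isolated cycles: $I_e$ is the subgraph induced by all elementary cycles $c\in\mathrm{O}_{\mathrm{el}}(G)$ with $e\in c$ such that $c$ shares no vertex with any elementary cycle of $G\setminus\vec F(e)$. A minimum $s$-$t$-cut in $G_e$ is a set of arcs of $G_e$ of minimum total weight whose removal leaves no directed path from $s$ to $t$ in $G_e$. -}

module Defs where

open import Level using (0ℓ)
open import Data.Nat using (ℕ)
open import Data.Fin using (Fin; _≟_)
open import Data.Fin.Subset using (Subset; _∈_; _∉_)
open import Data.Bool using (Bool; if_then_else_; _∧_)
open import Data.Vec using (Vec; lookup; tabulate)
open import Data.List using (List; []; _∷_; map)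
open import Data.List.Relation.Unary.All using (All)
open import Data.List.Relation.Unary.Unique.Propositional using (Unique)
import Data.List.Membership.Propositional as LMem
open import Data.Product using (Σ; ∃; ∃-syntax; _×_; _,_)
open import Relation.Binary.PropositionalEquality using (_≡_; _≢_)
open import Relation.Nullary using (¬_; does)
open import Algebra.Structures using (IsAbelianGroup)
open import Relation.Binary.Structures using (IsTotalOrder)

-- Weight domain: a totally ordered abelian group (ℝ with + and ≤ is one;
-- the statement only uses the additive ordered structure of ℝ).

record OrderedAbelianGroup : Set₁ where
  infixl 6 _+_ _-_
  infix 4 _≤_ _<_
  field
    Carrier        : Set
    _+_            : Carrier → Carrier → Carrier
    0#             : Carrier
    -_             : Carrier → Carrier
    _≤_            : Carrier → Carrier → Set
    isAbelianGroup : IsAbelianGroup _≡_ _+_ 0# -_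
    isTotalOrder   : IsTotalOrder _≡_ _≤_
    +-monoˡ-≤      : ∀ {x y} z → x ≤ y → x + z ≤ y + z

  _<_ : Carrier → Carrier → Set
  x < y = (x ≤ y) × (x ≢ y)

  _-_ : Carrier → Carrier → Carrier
  x - y = x + (- y)

-- Multi-digraphs: V = Fin nV, E = Fin nE, arbitrary head/tail maps.
-- An arc a goes from tail a to head a.

record MultiDigraph : Set where
  field
    nV   : ℕ
    nE   : ℕ
    head : Fin nE → Fin nV
    tail : Fin nE → Fin nV

module _ (G : MultiDigraph) where
  open MultiDigraph G

  Vertex : Set
  Vertex = Fin nV

  Arc : Set
  Arc = Fin nE

  ArcPred : Set₁
  ArcPred = Arc → Set

  data Walk : Vertex → Vertex → List Arc → Set where
    nil  : ∀ {v} → Walk v v []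
    cons : ∀ {a w as} → Walk (head a) w as → Walk (tail a) w (a ∷ as)

  IsCycle : List Arc → Set
  IsCycle c = (c ≢ []) × (∃[ v ] Walk v v c)

  cycleVertices : List Arc → List Vertex
  cycleVertices c = map tail c

  IsElemCycle : List Arc → Set
  IsElemCycle c = IsCycle c × Unique (cycleVertices c)

  -- Cycle lying in the subgraph with arc set H (vertex set unrestricted,
  -- which does not matter since arcs carry their endpoints).
  CycleIn : ArcPred → List Arc → Set
  CycleIn H c = IsCycle c × All H c

  ElemCycleIn : ArcPred → List Arc → Set
  ElemCycleIn H c = IsElemCycle c × All H c

  Minus : ArcPred → ArcPred
  Minus A a = ¬ A a

  Everything : ArcPred
  Everything _ = Data.Unit.⊤
    where import Data.Unit

  parallel : Arc → Subset nE
  parallel e = tabulate λ f → does (head f ≟ head e) ∧ does (tail f ≟ tail e)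

  inS : Subset nE → ArcPred
  inS A a = a ∈ A

  CoverCycle : Arc → List Arc → Set
  CoverCycle e c = IsElemCycle c × ∃[ f ] (f ∈ parallel e × f LMem.∈ c)

  InCover : Arc → ArcPred
  InCover e a = ∃[ c ] (CoverCycle e c × a LMem.∈ c)

  CoverNonEmpty : Arc → Set
  CoverNonEmpty e = ∃[ c ] CoverCycle e c

  IsolatedCycle : Arc → List Arc → Set
  IsolatedCycle e c =
    IsElemCycle c × e LMem.∈ c ×
    (∀ c' → ElemCycleIn (Minus (inS (parallel e))) c' →
       ∀ v → v LMem.∈ cycleVertices c → ¬ (v LMem.∈ cycleVertices c'))

  IsolatedEmpty : Arc → Set
  IsolatedEmpty e = ∀ c → ¬ IsolatedCycle e c

  module Weighted (R : OrderedAbelianGroup) (ω : Arc → OrderedAbelianGroup.Carrier R) where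
    open OrderedAbelianGroup R

    sumFin : ∀ {k} → (Fin k → Carrier) → Carrier
    sumFin {ℕ.zero}  f = 0#
    sumFin {ℕ.suc k} f = f Fin.zero + sumFin (λ i → f (Fin.suc i))
      where import Data.Fin as Fin

    Ω : Subset nE → Carrier
    Ω A = sumFin λ a → if lookup A a then ω a else 0#

    IsFAS : ArcPred → Subset nE → Set
    IsFAS H A = (∀ a → a ∈ A → H a) ×
                (∀ c → ¬ CycleIn (λ a → H a × a ∉ A) c)

    IsMinFAS : ArcPred → Subset nE → Set
    IsMinFAS H A = IsFAS H A × (∀ B → IsFAS H B → Ω A ≤ Ω B)

    IsCut : ArcPred → Vertex → Vertex → Subset nE → Set
    IsCut H s t D = (∀ a → a ∈ D → H a) ×
                    (∀ p → All (λ a → H a × a ∉ D) p → ¬ Walk s t p)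

    IsMinCut : ArcPred → Vertex → Vertex → Subset nE → Set
    IsMinCut H s t D = IsCut H s t D × (∀ D' → IsCut H s t D' → Ω D ≤ Ω D')

-- Suppose some arc g ∈ F⃗(e) (so g runs from t = tail e to
-- s = head e) is missing from the minimum feedback arc set ε, and let
-- ε' = ε ∩ 𝓔(G_e).  Then
--   (1) ε' is an s-t-cut of G_e: an s-t-path avoiding ε' avoids ε, and g
--       closes it to a cycle avoiding ε;            hence Ω(δ)  ≤ Ω(ε');
--   (2) ε ∖ ε' is a feedback arc set of G ∖ ε';    hence Ω(A₂) ≤ Ω(ε ∖ ε');
--   (3) A₁ ∪ F⃗(e) is a feedback arc set of G;     hence Ω(ε)  ≤ Ω(A₁ ∪ F⃗(e)).
-- Adding up, Ω(δ) + Ω(A₂) ≤ Ω(ε) ≤ Ω(A₁) + Ω(F⃗(e)), i.e.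
-- Ω(δ) − Ω(F⃗(e)) ≤ Ω(A₁) − Ω(A₂), contradicting the strict hypothesis.
-- Membership in ε is decidable, so this contradiction proves F⃗(e) ⊆ ε.

module Submission where

open import Defs
open import Data.Fin.Subset using (Subset; _∈_; _⊆_)
open import Data.Product using (_×_; _,_; proj₁; proj₂)
open import Function.Bundles using (_⇔_; module Equivalence)

open import Level using (0ℓ)
open import Data.Nat using (zero; suc)
open import Data.Fin using (Fin; _≟_)
import Data.Fin as Fin
open import Data.Fin.Subset using (_∉_; _∪_; _─_; outside)
open import Data.Fin.Subset.Properties
  using (_∈?_; p⊆p∪q; q⊆p∪q; x∈p∪q⁻; x∈p∧x∉q⇒x∈p─q; p─q⊆p)
open import Data.Bool using (true; false; if_then_else_; T)
open import Data.Bool.Properties using (T-≡)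
open import Data.Vec using (_∷_; lookup; here; there)
open import Data.Vec.Properties using (lookup∘tabulate; []=⇒lookup; lookup⇒[]=)
open import Data.List using (_∷_)
open import Data.List.Relation.Unary.All as All using (_∷_)
open import Data.Sum using (inj₁; inj₂)
open import Data.Unit using (tt)
open import Data.Empty using (⊥-elim)
open import Function using (_∘_)
open import Relation.Nullary using (¬_; Dec; yes; no; does)
open import Relation.Nullary.Decidable using (_×-dec_; decidable-stable)
open import Relation.Binary.Bundles using (Poset)
open import Relation.Binary.PropositionalEquality
  using (_≡_; refl; sym; trans; cong; cong₂; subst₂; module ≡-Reasoning)
open import Algebra.Structures using (IsAbelianGroup)
open import Relation.Binary.Structures using (IsTotalOrder)
import Relation.Binary.Reasoning.PartialOrder as PosetReasoning

open Equivalence using (to; from)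

x∈p─q⇒x∉q : ∀ {n} (p q : Subset n) {x} → x ∈ p ─ q → x ∉ q
x∈p─q⇒x∉q (_ ∷ p) (outside ∷ q) here          ()
x∈p─q⇒x∉q (_ ∷ p) (_ ∷ q)       (there x∈p─q) (there x∈q) = x∈p─q⇒x∉q p q x∈p─q x∈q

does-sound : ∀ {P : Set} (P? : Dec P) → T (does P?) → P
does-sound (yes p) _ = p

module OrderedGroupFacts (R : OrderedAbelianGroup) where
  open OrderedAbelianGroup R
  open IsAbelianGroup isAbelianGroup using (assoc; comm; identityˡ; identityʳ; inverseʳ)
  open IsTotalOrder isTotalOrder using (antisym; isPartialOrder) renaming (trans to ≤-trans)

  poset : Poset 0ℓ 0ℓ 0ℓ
  poset = record { isPartialOrder = isPartialOrder }

  module ≤-Reasoning = PosetReasoning poset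

  +-monoʳ-≤ : ∀ z {x y} → x ≤ y → z + x ≤ z + y
  +-monoʳ-≤ z {x} {y} x≤y = subst₂ _≤_ (comm x z) (comm y z) (+-monoˡ-≤ z x≤y)

  +-mono-≤ : ∀ {x y u v} → x ≤ y → u ≤ v → x + u ≤ y + v
  +-mono-≤ {y = y} {u} x≤y u≤v = ≤-trans (+-monoˡ-≤ u x≤y) (+-monoʳ-≤ y u≤v)

  x≤x+y : ∀ x {y} → 0# ≤ y → x ≤ x + y
  x≤x+y x {y} 0≤y = subst₂ _≤_ (identityʳ x) refl (+-monoʳ-≤ x 0≤y)

  y≤x+y : ∀ {x} y → 0# ≤ x → y ≤ x + y
  y≤x+y {x} y 0≤x = subst₂ _≤_ refl (comm y x) (x≤x+y y 0≤x)

  0≤x+y : ∀ {x y} → 0# ≤ x → 0# ≤ y → 0# ≤ x + y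
  0≤x+y {x} 0≤x 0≤y = ≤-trans 0≤x (x≤x+y x 0≤y)

  cancel : ∀ x y u → (x + y) + (- y + u) ≡ x + u
  cancel x y u = begin
    (x + y) + (- y + u)  ≡⟨ assoc x y (- y + u) ⟩
    x + (y + (- y + u))  ≡⟨ cong (x +_) (sym (assoc y (- y) u)) ⟩
    x + ((y - y) + u)    ≡⟨ cong (λ z → x + (z + u)) (inverseʳ y) ⟩
    x + (0# + u)         ≡⟨ cong (x +_) (identityˡ u) ⟩
    x + u                ∎
    where open ≡-Reasoning

  ≤-transpose : ∀ {x y z w} → x + y ≤ z + w → x - w ≤ z - y
  ≤-transpose {x} {y} {z} {w} le = subst₂ _≤_ (cancel x y (- w)) rhs (+-monoˡ-≤ (- y - w) le)
    where
    rhs : (z + w) + (- y - w) ≡ z - y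
    rhs = begin
      (z + w) + (- y - w)  ≡⟨ cong ((z + w) +_) (comm (- y) (- w)) ⟩
      (z + w) + (- w - y)  ≡⟨ cancel z w (- y) ⟩
      z - y                ∎
      where open ≡-Reasoning

  <⇒≱ : ∀ {x y} → x < y → ¬ (y ≤ x)
  <⇒≱ (x≤y , x≢y) y≤x = x≢y (antisym x≤y y≤x)

module ArcSetWeights (G : MultiDigraph) (R : OrderedAbelianGroup)
    (ω : Arc G → OrderedAbelianGroup.Carrier R) where
  open MultiDigraph G
  open OrderedAbelianGroup R
  open Weighted G R ω
  open OrderedGroupFacts R
  open IsAbelianGroup isAbelianGroup using (assoc; comm; identityˡ; identityʳ)
  open IsTotalOrder isTotalOrder using () renaming (refl to ≤-refl)

  sumFin-mono : ∀ {k} (f g : Fin k → Carrier) → (∀ i → f i ≤ g i) → sumFin f ≤ sumFin g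
  sumFin-mono {zero}  f g f≤g = ≤-refl
  sumFin-mono {suc k} f g f≤g =
    +-mono-≤ (f≤g Fin.zero) (sumFin-mono (f ∘ Fin.suc) (g ∘ Fin.suc) (f≤g ∘ Fin.suc))

  sumFin-cong : ∀ {k} (f g : Fin k → Carrier) → (∀ i → f i ≡ g i) → sumFin f ≡ sumFin g
  sumFin-cong {zero}  f g f≡g = refl
  sumFin-cong {suc k} f g f≡g =
    cong₂ _+_ (f≡g Fin.zero) (sumFin-cong (f ∘ Fin.suc) (g ∘ Fin.suc) (f≡g ∘ Fin.suc))

  private
    interchange : ∀ a b c d → (a + b) + (c + d) ≡ (a + c) + (b + d)
    interchange a b c d = begin
      (a + b) + (c + d)  ≡⟨ assoc a b (c + d) ⟩
      a + (b + (c + d))  ≡⟨ cong (a +_) (sym (assoc b c d)) ⟩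
      a + ((b + c) + d)  ≡⟨ cong (λ z → a + (z + d)) (comm b c) ⟩
      a + ((c + b) + d)  ≡⟨ cong (a +_) (assoc c b d) ⟩
      a + (c + (b + d))  ≡⟨ sym (assoc a c (b + d)) ⟩
      (a + c) + (b + d)  ∎
      where open ≡-Reasoning

  sumFin-+ : ∀ {k} (f g : Fin k → Carrier) → sumFin (λ i → f i + g i) ≡ sumFin f + sumFin g
  sumFin-+ {zero}  f g = sym (identityˡ 0#)
  sumFin-+ {suc k} f g = begin
    (f Fin.zero + g Fin.zero) + sumFin (λ i → f (Fin.suc i) + g (Fin.suc i))
      ≡⟨ cong (f Fin.zero + g Fin.zero +_) (sumFin-+ (f ∘ Fin.suc) (g ∘ Fin.suc)) ⟩
    (f Fin.zero + g Fin.zero) + (sumFin (f ∘ Fin.suc) + sumFin (g ∘ Fin.suc))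
      ≡⟨ interchange _ _ _ _ ⟩
    sumFin f + sumFin g
      ∎
    where open ≡-Reasoning

  weight : Subset nE → Arc G → Carrier
  weight A a = if lookup A a then ω a else 0#

  weight-∈ : ∀ {A a} → a ∈ A → weight A a ≡ ω a
  weight-∈ a∈A rewrite []=⇒lookup a∈A = refl

  weight-∉ : ∀ {A a} → a ∉ A → weight A a ≡ 0#
  weight-∉ {A} {a} a∉A with lookup A a in eq
  ... | true  = ⊥-elim (a∉A (lookup⇒[]= a A eq))
  ... | false = refl

  weight-─ : ∀ A B → B ⊆ A → ∀ a → weight B a + weight (A ─ B) a ≡ weight A a
  weight-─ A B B⊆A a with a ∈? B | a ∈? A
  ... | yes a∈B | _ = begin
    weight B a + weight (A ─ B) a  ≡⟨ cong₂ _+_ (weight-∈ a∈B)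
                                                (weight-∉ λ a∈A─B → x∈p─q⇒x∉q A B a∈A─B a∈B) ⟩
    ω a + 0#                       ≡⟨ identityʳ (ω a) ⟩
    ω a                            ≡⟨ weight-∈ (B⊆A a∈B) ⟨
    weight A a                     ∎
    where open ≡-Reasoning
  ... | no a∉B | yes a∈A = begin
    weight B a + weight (A ─ B) a  ≡⟨ cong₂ _+_ (weight-∉ a∉B)
                                                (weight-∈ (x∈p∧x∉q⇒x∈p─q a∈A a∉B)) ⟩
    0# + ω a                       ≡⟨ identityˡ (ω a) ⟩
    ω a                            ≡⟨ weight-∈ a∈A ⟨
    weight A a                     ∎
    where open ≡-Reasoning
  ... | no a∉B | no a∉A = begin
    weight B a + weight (A ─ B) a  ≡⟨ cong₂ _+_ (weight-∉ a∉B) (weight-∉ (a∉A ∘ p─q⊆p A B)) ⟩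
    0# + 0#                        ≡⟨ identityˡ 0# ⟩
    0#                             ≡⟨ weight-∉ a∉A ⟨
    weight A a                     ∎
    where open ≡-Reasoning

  Ω-─ : ∀ A B → B ⊆ A → Ω B + Ω (A ─ B) ≡ Ω A
  Ω-─ A B B⊆A = trans (sym (sumFin-+ (weight B) (weight (A ─ B))))
                      (sumFin-cong _ (weight A) (weight-─ A B B⊆A))

  module _ (nonneg : ∀ a → 0# ≤ ω a) where

    weight-nonneg : ∀ A a → 0# ≤ weight A a
    weight-nonneg A a with lookup A a
    ... | true  = nonneg a
    ... | false = ≤-refl

    weight-∪ : ∀ A B a → weight (A ∪ B) a ≤ weight A a + weight B a
    weight-∪ A B a with a ∈? A ∪ B
    ... | no a∉A∪B = begin
      weight (A ∪ B) a        ≡⟨ weight-∉ a∉A∪B ⟩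
      0#                      ≤⟨ 0≤x+y (weight-nonneg A a) (weight-nonneg B a) ⟩
      weight A a + weight B a ∎
      where open ≤-Reasoning
    ... | yes a∈A∪B with x∈p∪q⁻ A B a∈A∪B
    ...   | inj₁ a∈A = begin
      weight (A ∪ B) a        ≡⟨ trans (weight-∈ a∈A∪B) (sym (weight-∈ a∈A)) ⟩
      weight A a              ≤⟨ x≤x+y (weight A a) (weight-nonneg B a) ⟩
      weight A a + weight B a ∎
      where open ≤-Reasoning
    ...   | inj₂ a∈B = begin
      weight (A ∪ B) a        ≡⟨ trans (weight-∈ a∈A∪B) (sym (weight-∈ a∈B)) ⟩
      weight B a              ≤⟨ y≤x+y (weight B a) (weight-nonneg A a) ⟩
      weight A a + weight B a ∎
      where open ≤-Reasoning

    Ω-∪ : ∀ A B → Ω (A ∪ B) ≤ Ω A + Ω B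
    Ω-∪ A B = subst₂ _≤_ refl (sumFin-+ (weight A) (weight B))
                (sumFin-mono (weight (A ∪ B)) _ (weight-∪ A B))

module Walks (G : MultiDigraph) where
  open MultiDigraph G

  parallel-endpoints : ∀ {e g} → g ∈ parallel G e → (head g ≡ head e) × (tail g ≡ tail e)
  parallel-endpoints {e} {g} g∈F =
    does-sound ((head g ≟ head e) ×-dec (tail g ≟ tail e))
               (from T-≡ (trans (sym (lookup∘tabulate _ g)) ([]=⇒lookup g∈F)))

  close-path : ∀ {g p} → Walk G (head g) (tail g) p → IsCycle G (g ∷ p)
  close-path {g} path = (λ ()) , tail g , cons path

  IsRestriction : Subset nE → Subset nE → ArcPred G → Set
  IsRestriction C A H = ∀ a → (a ∈ C) ⇔ (a ∈ A × H a)

module FeedbackArcSets (G : MultiDigraph) (R : OrderedAbelianGroup)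
    (ω : Arc G → OrderedAbelianGroup.Carrier R) where
  open MultiDigraph G
  open OrderedAbelianGroup R
  open Weighted G R ω
  open Walks G
  open OrderedGroupFacts R
  open ArcSetWeights G R ω

  fas-extend : ∀ {A B} → IsFAS (Minus G (inS G B)) A → IsFAS (Everything G) (A ∪ B)
  fas-extend {A} {B} (_ , acyclic) = (λ _ _ → tt) , λ c (cycle , avoids) →
    acyclic c (cycle , All.map (λ (_ , a∉A∪B) → a∉A∪B ∘ q⊆p∪q A B , a∉A∪B ∘ p⊆p∪q B) avoids)

  fas-restrict : ∀ {A B} → IsFAS (Everything G) A → IsFAS (Minus G (inS G B)) (A ─ B)
  fas-restrict {A} {B} (_ , acyclic) = (λ _ → x∈p─q⇒x∉q A B) , λ c (cycle , avoids) →
    acyclic c (cycle , All.map (λ (a∉B , a∉A─B) → tt , λ a∈A → a∉A─B (x∈p∧x∉q⇒x∈p─q a∈A a∉B)) avoids)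

  restriction-isCut : ∀ {A C H g} → IsFAS (Everything G) A → g ∉ A →
                      IsRestriction C A H → IsCut H (head g) (tail g) C
  restriction-isCut {A} {C} {H} {g} (_ , acyclic) g∉A C-def =
    (λ a a∈C → proj₂ (to (C-def a) a∈C)) , λ p avoids path →
      acyclic (g ∷ p) (close-path path , (tt , g∉A) ∷ All.map avoid-A avoids)
    where
    avoid-A : ∀ {a} → H a × a ∉ C → Everything G a × a ∉ A
    avoid-A {a} (a∈H , a∉C) = tt , λ a∈A → a∉C (from (C-def a) (a∈A , a∈H))

  feedback-bound : (∀ a → 0# ≤ ω a) → ∀ {H F g δ ε ε' A₁ A₂} →
    IsMinCut H (head g) (tail g) δ → IsMinFAS (Everything G) ε → g ∉ ε →
    IsRestriction ε' ε H →
    IsMinFAS (Minus G (inS G F)) A₁ → IsMinFAS (Minus G (inS G ε')) A₂ →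
    Ω δ + Ω A₂ ≤ Ω A₁ + Ω F
  feedback-bound nonneg {F = F} {δ = δ} {ε = ε} {ε' = ε'} {A₁ = A₁} {A₂ = A₂}
                 (_ , δ-min) (ε-fas , ε-min) g∉ε ε'-def (A₁-fas , _) (_ , A₂-min) = begin
    Ω δ + Ω A₂         ≤⟨ +-mono-≤ (δ-min ε' (restriction-isCut ε-fas g∉ε ε'-def))
                                   (A₂-min (ε ─ ε') (fas-restrict ε-fas)) ⟩
    Ω ε' + Ω (ε ─ ε')  ≡⟨ Ω-─ ε ε' (λ {a} → proj₁ ∘ to (ε'-def a)) ⟩
    Ω ε                ≤⟨ ε-min (A₁ ∪ F) (fas-extend A₁-fas) ⟩
    Ω (A₁ ∪ F)         ≤⟨ Ω-∪ nonneg A₁ F ⟩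
    Ω A₁ + Ω F         ∎
    where open ≤-Reasoning

proposition3p2 : (G : MultiDigraph) (R : OrderedAbelianGroup)
    (ω : Arc G → OrderedAbelianGroup.Carrier R) →
    (∀ a → OrderedAbelianGroup._<_ R (OrderedAbelianGroup.0# R) (ω a)) →
    (e : Arc G) →
    CoverNonEmpty G e →
    IsolatedEmpty G e →
    (δ : Subset (MultiDigraph.nE G)) →
    Weighted.IsMinCut G R ω (InCover G e)
      (MultiDigraph.head G e) (MultiDigraph.tail G e) δ →
    (ε : Subset (MultiDigraph.nE G)) →
    Weighted.IsMinFAS G R ω (Everything G) ε →
    (ε' : Subset (MultiDigraph.nE G)) →
    (∀ a → (a ∈ ε') ⇔ (a ∈ ε × InCover G e a)) →
    (A₁ : Subset (MultiDigraph.nE G)) →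
    Weighted.IsMinFAS G R ω (Minus G (inS G (parallel G e))) A₁ →
    (A₂ : Subset (MultiDigraph.nE G)) →
    Weighted.IsMinFAS G R ω (Minus G (inS G ε')) A₂ →
    OrderedAbelianGroup._<_ R
      (OrderedAbelianGroup._-_ R (Weighted.Ω G R ω A₁) (Weighted.Ω G R ω A₂))
      (OrderedAbelianGroup._-_ R (Weighted.Ω G R ω δ) (Weighted.Ω G R ω (parallel G e))) →
    parallel G e ⊆ ε
proposition3p2 G R ω pos e _ _ δ δ-min ε ε-min ε' ε'-def A₁ A₁-min A₂ A₂-min gap {g} g∈F =
  decidable-stable (g ∈? ε) λ g∉ε →
    <⇒≱ gap (≤-transpose (feedback-bound nonneg δ-min-at-g ε-min g∉ε ε'-def A₁-min A₂-min))
  where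
  open MultiDigraph G
  open OrderedGroupFacts R
  open Walks G
  open FeedbackArcSets G R ω

  nonneg : ∀ a → OrderedAbelianGroup._≤_ R (OrderedAbelianGroup.0# R) (ω a)
  nonneg = proj₁ ∘ pos

  -- g is parallel to e, so δ is also a minimum head g–tail g cut of G_e
  δ-min-at-g : Weighted.IsMinCut G R ω (InCover G e) (head g) (tail g) δ
  δ-min-at-g = subst₂ (λ s t → Weighted.IsMinCut G R ω (InCover G e) s t δ)
                      (sym (proj₁ (parallel-endpoints g∈F))) (sym (proj₂ (parallel-endpoints g∈F)))
                      δ-min
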